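{- Let $p$ be a prime. Let $N_p$ denote the set $\mathbb{N}=\{0,1,2,\dots\}$ equipped with the $p$-adic metric $d_p(m,n)=p^{ -v(m-n)}$ (with $d_p(m,m)=0$), where $v(k)$ is the largest power of $p$ dividing $k$. For an integer $n$, let $[n]_p\in\{0,\dots,p-1\}$ be the residue of $n$ modulo $p$ and let $k_p(n)$ be the unique integer with $n=k_p(n)p+[n]_p$. Define \[M: N_p\times N_p\to \tfrac{1}{p}(N_p\times N_p)\times V_p,\qquad M(m,n)=\bigl(M_2(m,n),M_1(m,n),M_0(m,n)\bigr),\] where $M_0(m,n)=[mn]_p$, \[M_1(m,n)=\begin{cases} m & \text{if } [n]_p=0,\\ k_p(mn) & \text{if } [n]_p\neq 0,\end{cases}\qquad M_2(m,n)=\begin{cases} k_p(n) & \text{if } [n]_p=0,\\ 1 & \text{if } [n]_p\neq 0.\end{cases}\] Then $M$ is a nonexpanding map, i.e. $d(M(x),M(y))\le d(x,y)$ for all $x,y\in N_p\times N_p$.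
   Context: All metric spaces are $1$-bounded. Products of metric spaces carry the maximum metric. For a metric space $X$ with metric $d$, $\tfrac{1}{p}X$ denotes the same set with metric $\tfrac{1}{p}d$. $V_p$ denotes the set $\{0,1,\dots,p-1\}$ with the discrete metric (distance $1$ between distinct points). A map $f:X\to Y$ is nonexpanding if $d_Y(f(x),f(y))\le d_X(x,y)$ for all $x,y$. -}

module Defs where

open import Data.Nat as ℕ using (ℕ; zero; suc; _+_; _*_; _∸_; _^_; NonZero)
open import Data.Nat.Properties using (m^n≢0)
open import Data.Nat.DivMod using (_/_; _%_; _mod_)
open import Data.Fin using (Fin)
open import Data.Integer using (+_)
open import Data.Rational as ℚ using (ℚ; 0ℚ; 1ℚ; _⊔_)
open import Data.Product using (_×_; _,_)
open import Relation.Nullary using (yes; no)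
open import Relation.Nullary.Decidable using (⌊_⌋)
open import Data.Bool using (if_then_else_)
import Data.Fin as Fin

module PAdic (p : ℕ) .{{p≢0 : NonZero p}} where

  -- p-adic valuation with fuel: number of times p divides k (k ≠ 0).
  -- With fuel ≥ k (and p ≥ 2) this is exactly the largest e with p^e ∣ k.
  valF : ℕ → ℕ → ℕ
  valF zero    k = 0
  valF (suc f) zero = 0
  valF (suc f) k@(suc _) with k % p ℕ.≟ 0
  ... | yes _ = suc (valF f (k / p))
  ... | no  _ = 0

  v : ℕ → ℕ
  v k = valF k k

  absDiff : ℕ → ℕ → ℕ
  absDiff m n = (m ∸ n) + (n ∸ m)

  dₚ : ℕ → ℕ → ℚ
  dₚ m n with m ℕ.≟ n
  ... | yes _ = 0ℚ
  ... | no  _ = let instance _ = m^n≢0 p (v (absDiff m n)) in (+ 1) ℚ./ (p ^ v (absDiff m n))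

  -- discrete metric on V_p = Fin p
  dV : Fin p → Fin p → ℚ
  dV a b = if ⌊ a Fin.≟ b ⌋ then 0ℚ else 1ℚ

  d₂ : ℕ × ℕ → ℕ × ℕ → ℚ
  d₂ (m , n) (m' , n') = dₚ m m' ⊔ dₚ n n'

  invp : ℚ
  invp = (+ 1) ℚ./ p

  -- metric on (1/p)(N_p × N_p) × V_p  (max metric)
  dTarget : (ℕ × ℕ) × Fin p → (ℕ × ℕ) × Fin p → ℚ
  dTarget (x , a) (y , b) = (invp ℚ.* d₂ x y) ⊔ dV a b

  res : ℕ → ℕ
  res n = n % p

  kₚ : ℕ → ℕ
  kₚ n = n / p

  M₀ : ℕ → ℕ → Fin p
  M₀ m n = (m * n) mod p

  M₁ : ℕ → ℕ → ℕ
  M₁ m n with res n ℕ.≟ 0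
  ... | yes _ = m
  ... | no  _ = kₚ (m * n)

  M₂ : ℕ → ℕ → ℕ
  M₂ m n with res n ℕ.≟ 0
  ... | yes _ = kₚ n
  ... | no  _ = 1

  M : ℕ × ℕ → (ℕ × ℕ) × Fin p
  M (m , n) = ((M₂ m n , M₁ m n) , M₀ m n)

module Submission where

-- Both metrics are governed by divisibility: dₚ m n ≤ p⁻ᵉ = 1/pᵉ as soon as
-- pᵉ divides |m - n|, with equality for e = v(m - n).  Hence for x ≠ y the
-- distance d₂ x y equals p⁻ᵉ for an e such that x and y are "e-close"
-- (both coordinate differences divisible by pᵉ).  The heart of the proof is
-- purely arithmetic (M-close, labels-agree): if x, y are (e+1)-close then the
-- ℕ × ℕ parts of M x and M y are e-close and their V_p parts agree.  Since the
-- first factor of the target is scaled by 1/p, this gives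
-- dTarget (M x) (M y) ≤ p⁻ᵉ ≤ d₂ x y.  Nothing beyond p ≥ 2 is used.

open import Defs
open import Data.Nat using (ℕ)
open import Data.Nat.Primality using (Prime; prime⇒nonZero; prime⇒nonTrivial)
open import Data.Product using (_×_)
open import Data.Rational using (_≤_)

open import Data.Nat as ℕ
  using (zero; suc; _+_; _*_; _∸_; _^_; ∣_-_∣; NonZero; z≤n; s≤s; _<_)
open import Data.Nat.Properties as ℕP
  using (≤-total; m≤n⇒m∸n≡0; m≤n⇒∣m-n∣≡n∸m; m≤n⇒∣n-m∣≡n∸m; m+[n∸m]≡n;
         ∣-∣-comm; ∣n-n∣≡0; ∣m-n∣≡0⇒m≡n; *-distribʳ-∣-∣; m^n≢0)
open import Data.Nat.DivMod
  using (_/_; _%_; _mod_; m≡m%n+[m/n]*n; %-remove-+ʳ; %-distribˡ-*;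
         m/n*n≡m; m/n<m; m≥n⇒m/n>0)
open import Data.Nat.Divisibility
  using (_∣_; m%n≡0⇒n∣m; n∣m⇒m%n≡0; ∣-trans; m∣m*n; n∣m*n; _∣0; 1∣_; *-monoʳ-∣; *-cancelʳ-∣; ∣⇒≤)
open import Data.Nat.Coprimality using (1-coprimeTo)
open import Data.Product using (_,_; proj₁; proj₂; ∃-syntax)
open import Data.Product.Properties using (≡-dec)
open import Data.Sum using (inj₁; inj₂)
open import Data.Empty using (⊥-elim)
open import Relation.Nullary using (Dec; yes; no; ¬_)
open import Relation.Binary.PropositionalEquality
import Data.Fin as Fin
open import Data.Fin.Properties using (toℕ-injective; toℕ-fromℕ<)
import Data.Integer as ℤ
import Data.Integer.Properties as ℤP
import Data.Rational as ℚ
import Data.Rational.Properties as ℚP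
open import Data.Rational using (ℚ; 0ℚ; 1ℚ; mkℚ)

absDiff≡∣-∣ : ∀ m n → (m ∸ n) + (n ∸ m) ≡ ∣ m - n ∣
absDiff≡∣-∣ m n with ≤-total m n
... | inj₁ m≤n = trans (cong (_+ (n ∸ m)) (m≤n⇒m∸n≡0 m≤n)) (sym (m≤n⇒∣m-n∣≡n∸m m≤n))
... | inj₂ n≤m = trans (cong ((m ∸ n) +_) (m≤n⇒m∸n≡0 n≤m))
                       (trans (ℕP.+-identityʳ (m ∸ n)) (sym (m≤n⇒∣n-m∣≡n∸m n≤m)))

∣-∣-translate : ∀ r a b → ∣ r + a - r + b ∣ ≡ ∣ a - b ∣
∣-∣-translate zero    a b = refl
∣-∣-translate (suc r) a b = ∣-∣-translate r a b

-- a ≡ b (mod d): d divides the distance |a - b|.  It is a record rather than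
-- an abbreviation so that a, b and d can be inferred from the type.
infix 4 _≡_[mod_]
record _≡_[mod_] (a b d : ℕ) : Set where
  constructor ∣⇒≡-mod
  field ≡-mod⇒∣ : d ∣ ∣ a - b ∣
open _≡_[mod_]

≡-mod-refl : ∀ a d → a ≡ a [mod d ]
≡-mod-refl a d = ∣⇒≡-mod (subst (d ∣_) (sym (∣n-n∣≡0 a)) (d ∣0))

≡⇒≡-mod : ∀ {a b d} → a ≡ b → a ≡ b [mod d ]
≡⇒≡-mod {a} {d = d} refl = ≡-mod-refl a d

≡-mod-weaken : ∀ {a b c d} → c ∣ d → a ≡ b [mod d ] → a ≡ b [mod c ]
≡-mod-weaken c∣d (∣⇒≡-mod d∣) = ∣⇒≡-mod (∣-trans c∣d d∣)

module _ (d : ℕ) .{{_ : NonZero d}} where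

  ∣-∣-quotient : ∀ a b → a % d ≡ b % d → ∣ a - b ∣ ≡ ∣ a / d - b / d ∣ * d
  ∣-∣-quotient a b eq = begin
    ∣ a - b ∣
      ≡⟨ cong₂ ∣_-_∣ (m≡m%n+[m/n]*n a d) (m≡m%n+[m/n]*n b d) ⟩
    ∣ a % d + a / d * d - b % d + b / d * d ∣
      ≡⟨ cong (λ r → ∣ a % d + a / d * d - r + b / d * d ∣) (sym eq) ⟩
    ∣ a % d + a / d * d - a % d + b / d * d ∣
      ≡⟨ ∣-∣-translate (a % d) (a / d * d) (b / d * d) ⟩
    ∣ a / d * d - b / d * d ∣
      ≡⟨ sym (*-distribʳ-∣-∣ d (a / d) (b / d)) ⟩
    ∣ a / d - b / d ∣ * d ∎
    where open ≡-Reasoning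

  %≡⇒≡-mod : ∀ a b → a % d ≡ b % d → a ≡ b [mod d ]
  %≡⇒≡-mod a b eq = ∣⇒≡-mod (subst (d ∣_) (sym (∣-∣-quotient a b eq)) (n∣m*n ∣ a / d - b / d ∣))

  -- For a ≤ b one has b = a + |a - b|, so the residues agree.
  ≡-mod⇒%≡-ordered : ∀ {a b} → a ℕ.≤ b → a ≡ b [mod d ] → a % d ≡ b % d
  ≡-mod⇒%≡-ordered {a} {b} a≤b (∣⇒≡-mod d∣) = begin
    a % d             ≡⟨ sym (%-remove-+ʳ a (subst (d ∣_) (m≤n⇒∣m-n∣≡n∸m a≤b) d∣)) ⟩
    (a + (b ∸ a)) % d ≡⟨ cong (_% d) (m+[n∸m]≡n a≤b) ⟩
    b % d             ∎
    where open ≡-Reasoning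

  ≡-mod⇒%≡ : ∀ a b → a ≡ b [mod d ] → a % d ≡ b % d
  ≡-mod⇒%≡ a b a≡b with ≤-total a b
  ... | inj₁ a≤b = ≡-mod⇒%≡-ordered a≤b a≡b
  ... | inj₂ b≤a = sym (≡-mod⇒%≡-ordered b≤a (∣⇒≡-mod (subst (d ∣_) (∣-∣-comm a b) (≡-mod⇒∣ a≡b))))

  ≡-mod-* : ∀ {a a' b b'} → a ≡ a' [mod d ] → b ≡ b' [mod d ] → a * b ≡ a' * b' [mod d ]
  ≡-mod-* {a} {a'} {b} {b'} a≡a' b≡b' = %≡⇒≡-mod (a * b) (a' * b') (begin
    (a * b) % d               ≡⟨ %-distribˡ-* a b d ⟩
    ((a % d) * (b % d)) % d   ≡⟨ cong₂ (λ r s → (r * s) % d) (≡-mod⇒%≡ a a' a≡a') (≡-mod⇒%≡ b b' b≡b') ⟩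
    ((a' % d) * (b' % d)) % d ≡⟨ sym (%-distribˡ-* a' b' d) ⟩
    (a' * b') % d             ∎)
    where open ≡-Reasoning

  %≡⇒mod≡ : ∀ a b → a % d ≡ b % d → a mod d ≡ b mod d
  %≡⇒mod≡ a b eq = toℕ-injective (trans (toℕ-fromℕ< _) (trans eq (sym (toℕ-fromℕ< _))))

  ≡-mod-quotient : ∀ {a b} c → a % d ≡ b % d → a ≡ b [mod d * c ] → a / d ≡ b / d [mod c ]
  ≡-mod-quotient {a} {b} c eq a≡b =
    ∣⇒≡-mod (*-cancelʳ-∣ d (subst₂ _∣_ (ℕP.*-comm d c) (∣-∣-quotient a b eq) (≡-mod⇒∣ a≡b)))

^-monoʳ-∣ : ∀ m {e f} → e ℕ.≤ f → m ^ e ∣ m ^ f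
^-monoʳ-∣ m {e} {f} e≤f = subst (m ^ e ∣_) mᵉ*mᶠ⁻ᵉ≡mᶠ (m∣m*n (m ^ (f ∸ e)))
  where
  mᵉ*mᶠ⁻ᵉ≡mᶠ : m ^ e * m ^ (f ∸ e) ≡ m ^ f
  mᵉ*mᶠ⁻ᵉ≡mᶠ = trans (sym (ℕP.^-distribˡ-+-* m e (f ∸ e))) (cong (m ^_) (m+[n∸m]≡n e≤f))

module Valuation (p : ℕ) .{{_ : NonZero p}} where
  open PAdic p

  p^valF∣ : ∀ f k → p ^ valF f k ∣ k
  p^valF∣ zero    k       = 1∣ k
  p^valF∣ (suc f) zero    = 1∣ 0
  p^valF∣ (suc f) (suc k) with suc k % p ℕ.≟ 0
  ... | yes k%p≡0 = subst (p * p ^ valF f (suc k / p) ∣_) k≡p*[k/p]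
                          (*-monoʳ-∣ p (p^valF∣ f (suc k / p)))
    where
    k≡p*[k/p] : p * (suc k / p) ≡ suc k
    k≡p*[k/p] = trans (ℕP.*-comm p _) (m/n*n≡m (m%n≡0⇒n∣m _ p k%p≡0))
  ... | no  _     = 1∣ suc k

  ∣⇒≤valF : 1 < p → ∀ e f k → 0 < k → k ℕ.≤ f → p ^ e ∣ k → e ℕ.≤ valF f k
  ∣⇒≤valF 1<p zero    f       k       _ _   _ = z≤n
  ∣⇒≤valF 1<p (suc e) zero    (suc k) _ ()  _
  ∣⇒≤valF 1<p (suc e) (suc f) (suc k) _ k≤f pᵉ⁺¹∣k with suc k % p ℕ.≟ 0
  ... | yes k%p≡0 = s≤s (∣⇒≤valF 1<p e f (suc k / p) k/p>0 k/p≤f pᵉ∣k/p)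
    where
    p∣k : p ∣ suc k
    p∣k = m%n≡0⇒n∣m _ p k%p≡0
    k/p>0 : 0 < suc k / p
    k/p>0 = m≥n⇒m/n>0 (∣⇒≤ p∣k)
    k/p≤f : suc k / p ℕ.≤ f
    k/p≤f = ℕP.≤-pred (ℕP.≤-trans (m/n<m (suc k) p 1<p) k≤f)
    pᵉ∣k/p : p ^ e ∣ suc k / p
    pᵉ∣k/p = *-cancelʳ-∣ p (subst₂ _∣_ (ℕP.*-comm p (p ^ e)) (sym (m/n*n≡m p∣k)) pᵉ⁺¹∣k)
  ... | no  k%p≢0 = ⊥-elim (k%p≢0 (n∣m⇒m%n≡0 _ p (∣-trans (m∣m*n (p ^ e)) pᵉ⁺¹∣k)))

  p^v∣ : ∀ k → p ^ v k ∣ k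
  p^v∣ k = p^valF∣ k k

  ∣⇒≤v : 1 < p → ∀ e k → 0 < k → p ^ e ∣ k → e ℕ.≤ v k
  ∣⇒≤v 1<p e k k>0 = ∣⇒≤valF 1<p e k k k>0 ℕP.≤-refl

1/ℕ : (n : ℕ) .{{_ : NonZero n}} → ℚ
1/ℕ n = ℤ.+ 1 ℚ./ n

1/ℕ-normal : ∀ n → 1/ℕ (suc n) ≡ mkℚ (ℤ.+ 1) n (1-coprimeTo (suc n))
1/ℕ-normal n = ℚP.normalize-coprime {1} {n} (1-coprimeTo (suc n))

1/ℕ-antitone : ∀ a b .{{_ : NonZero a}} .{{_ : NonZero b}} → a ℕ.≤ b → 1/ℕ b ≤ 1/ℕ a
1/ℕ-antitone (suc a) (suc b) a≤b rewrite 1/ℕ-normal a | 1/ℕ-normal b =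
  ℚ.*≤* (subst₂ ℤ._≤_ (sym (ℤP.*-identityˡ (ℤ.+ suc a))) (sym (ℤP.*-identityˡ (ℤ.+ suc b)))
                      (ℤ.+≤+ a≤b))

1/ℕ-nonNeg : ∀ n .{{_ : NonZero n}} → 0ℚ ≤ 1/ℕ n
1/ℕ-nonNeg n = ℚP.nonNegative⁻¹ (1/ℕ n) {{ℚP.normalize-nonNeg 1 n}}

1/ℕ-* : ∀ a b .{{a≢0 : NonZero a}} .{{b≢0 : NonZero b}} → 1/ℕ a ℚ.* 1/ℕ b ≡ 1/ℕ (a * b) {{ℕP.m*n≢0 a b}}
1/ℕ-* (suc a) (suc b) rewrite 1/ℕ-normal a | 1/ℕ-normal b = refl

module Nonexpanding (p : ℕ) .{{_ : NonZero p}} (1<p : 1 < p) where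
  open PAdic p
  open Valuation p

  p⁻ : ℕ → ℚ
  p⁻ e = 1/ℕ (p ^ e) {{m^n≢0 p e}}

  p⁻-nonNeg : ∀ e → 0ℚ ≤ p⁻ e
  p⁻-nonNeg e = 1/ℕ-nonNeg (p ^ e) {{m^n≢0 p e}}

  p⁻-antitone : ∀ {e f} → e ℕ.≤ f → p⁻ f ≤ p⁻ e
  p⁻-antitone {e} {f} e≤f =
    1/ℕ-antitone (p ^ e) (p ^ f) {{m^n≢0 p e}} {{m^n≢0 p f}} (ℕP.^-monoʳ-≤ p e≤f)

  invp*p⁻ : ∀ e → invp ℚ.* p⁻ e ≡ p⁻ (suc e)
  invp*p⁻ e = 1/ℕ-* p (p ^ e) {{b≢0 = m^n≢0 p e}}

  p∣pᵉ⁺¹ : ∀ e → p ∣ p ^ suc e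
  p∣pᵉ⁺¹ e = m∣m*n (p ^ e)

  pᵉ∣pᵉ⁺¹ : ∀ e → p ^ e ∣ p ^ suc e
  pᵉ∣pᵉ⁺¹ e = n∣m*n p

  dₚ-self : ∀ m → dₚ m m ≡ 0ℚ
  dₚ-self m with m ℕ.≟ m
  ... | yes _   = refl
  ... | no  m≢m = ⊥-elim (m≢m refl)

  dₚ-exact : ∀ m n → ¬ m ≡ n → dₚ m n ≡ p⁻ (v ∣ m - n ∣)
  dₚ-exact m n m≢n with m ℕ.≟ n
  ... | yes m≡n = ⊥-elim (m≢n m≡n)
  ... | no  _   = cong (λ k → p⁻ (v k)) (absDiff≡∣-∣ m n)

  -- Divisibility of m - n by pᵉ bounds dₚ m n by p⁻ᵉ (maximality of the valuation).
  dₚ-bound : ∀ e m n → m ≡ n [mod p ^ e ] → dₚ m n ≤ p⁻ e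
  dₚ-bound e m n m≡n with m ℕ.≟ n
  ... | yes _   = p⁻-nonNeg e
  ... | no  m≢n = subst (λ k → p⁻ (v k) ≤ p⁻ e) (sym (absDiff≡∣-∣ m n))
                        (p⁻-antitone (∣⇒≤v 1<p e ∣ m - n ∣ ∣m-n∣>0 (≡-mod⇒∣ m≡n)))
    where
    ∣m-n∣>0 : 0 < ∣ m - n ∣
    ∣m-n∣>0 = ℕP.n≢0⇒n>0 (λ ∣m-n∣≡0 → m≢n (∣m-n∣≡0⇒m≡n ∣m-n∣≡0))

  Close : ℕ → ℕ × ℕ → ℕ × ℕ → Set
  Close e (m , n) (m' , n') = m ≡ m' [mod p ^ e ] × n ≡ n' [mod p ^ e ]

  d₂-self : ∀ x → d₂ x x ≡ 0ℚ
  d₂-self (m , n) rewrite dₚ-self m | dₚ-self n = refl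

  d₂-bound : ∀ e x y → Close e x y → d₂ x y ≤ p⁻ e
  d₂-bound e (m , n) (m' , n') (m≡m' , n≡n') = ℚP.⊔-lub (dₚ-bound e m m' m≡m') (dₚ-bound e n n' n≡n')

  distance-close : ∀ m m' → m ≡ m' [mod p ^ v ∣ m - m' ∣ ]
  distance-close m m' = ∣⇒≡-mod (p^v∣ ∣ m - m' ∣)

  first-coordinate : ∀ m m' n n' → ¬ m ≡ m' → p⁻ (v ∣ m - m' ∣) ≤ d₂ (m , n) (m' , n')
  first-coordinate m m' n n' m≢m' =
    subst (_≤ d₂ (m , n) (m' , n')) (dₚ-exact m m' m≢m') (ℚP.p≤p⊔q (dₚ m m') (dₚ n n'))

  second-coordinate : ∀ m m' n n' → ¬ n ≡ n' → p⁻ (v ∣ n - n' ∣) ≤ d₂ (m , n) (m' , n')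
  second-coordinate m m' n n' n≢n' =
    subst (_≤ d₂ (m , n) (m' , n')) (dₚ-exact n n' n≢n') (ℚP.p≤q⊔p (dₚ m m') (dₚ n n'))

  -- For x ≠ y, d₂ x y is at least p⁻ᵉ for some e at which x and y are e-close
  -- (take e = v of a coordinate difference realising the maximum).
  d₂-attained : ∀ x y → ¬ x ≡ y → ∃[ e ] Close e x y × p⁻ e ≤ d₂ x y
  d₂-attained (m , n) (m' , n') x≢y = by-cases (m ℕ.≟ m') (n ℕ.≟ n')
    where
    by-cases : Dec (m ≡ m') → Dec (n ≡ n') → ∃[ e ] Close e (m , n) (m' , n') × p⁻ e ≤ d₂ (m , n) (m' , n')
    by-cases (yes m≡m') (yes n≡n') = ⊥-elim (x≢y (cong₂ _,_ m≡m' n≡n'))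
    by-cases (no  m≢m') (yes n≡n') =
      v ∣ m - m' ∣ , (distance-close m m' , ≡⇒≡-mod n≡n') , first-coordinate m m' n n' m≢m'
    by-cases (yes m≡m') (no  n≢n') =
      v ∣ n - n' ∣ , (≡⇒≡-mod m≡m' , distance-close n n') , second-coordinate m m' n n' n≢n'
    by-cases (no  m≢m') (no  n≢n') with ≤-total (v ∣ m - m' ∣) (v ∣ n - n' ∣)
    ... | inj₁ e₁≤e₂ = v ∣ m - m' ∣
        , (distance-close m m' , ≡-mod-weaken (^-monoʳ-∣ p e₁≤e₂) (distance-close n n'))
        , first-coordinate m m' n n' m≢m'
    ... | inj₂ e₂≤e₁ = v ∣ n - n' ∣
        , (≡-mod-weaken (^-monoʳ-∣ p e₂≤e₁) (distance-close m m') , distance-close n n')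
        , second-coordinate m m' n n' n≢n'

  dV-self : ∀ a → dV a a ≡ 0ℚ
  dV-self a with a Fin.≟ a
  ... | yes _   = refl
  ... | no  a≢a = ⊥-elim (a≢a refl)

  dV≤1 : ∀ a b → dV a b ≤ 1ℚ
  dV≤1 a b with a Fin.≟ b
  ... | yes _ = ℚP.nonNegative⁻¹ 1ℚ
  ... | no  _ = ℚP.≤-refl

  dTarget-self : ∀ X → dTarget X X ≡ 0ℚ
  dTarget-self (x , c) rewrite d₂-self x | dV-self c | ℚP.*-zeroʳ invp = refl

  scaled-d₂-bound : ∀ e x y → Close e x y → invp ℚ.* d₂ x y ≤ p⁻ (suc e)
  scaled-d₂-bound e x y close = ℚP.≤-trans
    (ℚP.*-monoˡ-≤-nonNeg invp {{ℚ.nonNegative (1/ℕ-nonNeg p)}} (d₂-bound e x y close))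
    (ℚP.≤-reflexive (invp*p⁻ e))

  dTarget-bound : ∀ e x y c c' → Close e x y → c ≡ c' → dTarget (x , c) (y , c') ≤ p⁻ (suc e)
  dTarget-bound e x y c .c close refl rewrite dV-self c =
    ℚP.⊔-lub (scaled-d₂-bound e x y close) (p⁻-nonNeg (suc e))

  dTarget≤1 : ∀ X Y → dTarget X Y ≤ 1ℚ
  dTarget≤1 (x , a) (y , b) = ℚP.⊔-lub
    (ℚP.≤-trans (scaled-d₂-bound 0 x y (∣⇒≡-mod (1∣ _) , ∣⇒≡-mod (1∣ _))) (p⁻-antitone {0} {1} z≤n))
    (dV≤1 a b)

  residues-agree : ∀ e {n n'} → n ≡ n' [mod p ^ suc e ] → res n ≡ res n'
  residues-agree e {n} {n'} n≡n' = ≡-mod⇒%≡ p n n' (≡-mod-weaken (p∣pᵉ⁺¹ e) n≡n')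

  products-close : ∀ e {m n m' n'} → Close (suc e) (m , n) (m' , n') → m * n ≡ m' * n' [mod p ^ suc e ]
  products-close e (m≡m' , n≡n') = ≡-mod-* (p ^ suc e) {{m^n≢0 p (suc e)}} m≡m' n≡n'

  labels-agree : ∀ e x y → Close (suc e) x y → proj₂ (M x) ≡ proj₂ (M y)
  labels-agree e (m , n) (m' , n') close =
    %≡⇒mod≡ p (m * n) (m' * n') (residues-agree e (products-close e close))

  M-close : ∀ e x y → Close (suc e) x y → Close e (proj₁ (M x)) (proj₁ (M y))
  M-close e (m , n) (m' , n') close@(m≡m' , n≡n') with res n ℕ.≟ 0 | res n' ℕ.≟ 0
  ... | yes _     | yes _      =
    ≡-mod-quotient p (p ^ e) (residues-agree e n≡n') n≡n' , ≡-mod-weaken (pᵉ∣pᵉ⁺¹ e) m≡m'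
  ... | yes n%p≡0 | no  n'%p≢0 = ⊥-elim (n'%p≢0 (trans (sym (residues-agree e n≡n')) n%p≡0))
  ... | no  n%p≢0 | yes n'%p≡0 = ⊥-elim (n%p≢0 (trans (residues-agree e n≡n') n'%p≡0))
  ... | no  _     | no  _      =
    ≡-mod-refl 1 (p ^ e) ,
    ≡-mod-quotient p (p ^ e) (residues-agree e (products-close e close)) (products-close e close)

  M-bound : ∀ e x y → Close e x y → dTarget (M x) (M y) ≤ p⁻ e
  M-bound zero    x y _     = dTarget≤1 (M x) (M y)
  M-bound (suc e) x y close = dTarget-bound e (proj₁ (M x)) (proj₁ (M y)) (proj₂ (M x)) (proj₂ (M y))
                                (M-close e x y close) (labels-agree e x y close)

  nonexpanding : ∀ x y → dTarget (M x) (M y) ≤ d₂ x y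
  nonexpanding x y with ≡-dec ℕ._≟_ ℕ._≟_ x y
  ... | yes refl = ℚP.≤-reflexive (trans (dTarget-self (M x)) (sym (d₂-self x)))
  ... | no  x≢y  with d₂-attained x y x≢y
  ...   | e , close , p⁻ᵉ≤d₂ = ℚP.≤-trans (M-bound e x y close) p⁻ᵉ≤d₂

mainTheorem2 : (p : ℕ) (pp : Prime p) →
    let open PAdic p ⦃ prime⇒nonZero pp ⦄ in
    (x y : ℕ × ℕ) → dTarget (M x) (M y) ≤ d₂ x y
mainTheorem2 p pp = nonexpanding
  where
  instance
    p≢0 : NonZero p
    p≢0 = prime⇒nonZero pp
  open Nonexpanding p (ℕ.nonTrivial⇒n>1 p {{prime⇒nonTrivial pp}})
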